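{- Let $G_1,\ldots,G_n$ be connected rooted graphs. Then \[\delta_0\left(\bigvee_{i=1}^{n} G_i\right)=\sum_{i=1}^{n}\delta_0(G_i)\] and \[\delta\left(\bigvee_{i=1}^{n} G_i\right)=\sum_{i=1}^{n}\delta(G_i)+2\sum_{i=1}^{n}\delta_0(G_i)\left(1-n+\sum_{j\neq i}|G_j|\right).\]
   Context: A rooted graph is a finite simple undirected graph with a distinguished vertex (the root); $|G|$ is its number of vertices. For connected $G$, $\delta(G)=\sum_{i,j\in V(G)}d(i,j)$ (sum of shortest-path distances over ordered pairs) and $\delta_0(G)=\sum_{j\in V(G)}d(v_0(G),j)$, where $v_0(G)$ is the root. The one-point union $G\lor H$ is obtained from disjoint copies of $G$ and $H$ by identifying their roots into a single vertex, which is the root of $G\lor H$; its edges are those of $G$ together with those of $H$. The iterated union is $\bigvee_{i=1}^{1}G_i=G_1$ and $\bigvee_{i=1}^{n}G_i=\left(\bigvee_{i=1}^{n-1}G_i\right)\lor G_n$ (i.e., all roots identified into one common root). -}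

module Defs where

open import Data.Nat using (ℕ; zero; suc; _+_)
open import Data.Bool using (Bool; true; false; _∧_; _∨_; if_then_else_)
open import Data.Fin using (Fin; zero; suc; splitAt; punchIn; inject₁; _↑ˡ_; fromℕ; _≟_)
open import Data.List using (allFin)
open import Data.Bool.ListAction using (any)
open import Data.Sum using (_⊎_; inj₁; inj₂)
open import Data.Maybe using (Maybe; just; nothing)
open import Data.Product using (_×_; ∃-syntax)
open import Relation.Nullary using (yes; no; does)
open import Data.Integer as ℤ using (ℤ)
open import Relation.Binary.PropositionalEquality using (_≡_)

∑ : (n : ℕ) → (Fin n → ℕ) → ℕ
∑ zero    f = 0
∑ (suc n) f = f zero + ∑ n (λ i → f (suc i))

∑ℤ : (n : ℕ) → (Fin n → ℤ) → ℤ
∑ℤ zero    f = ℤ.+ 0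
∑ℤ (suc n) f = f zero ℤ.+ ∑ℤ n (λ i → f (suc i))

-- ifNe j i x = x if j ≠ i, and 0 if j = i   (used for sums over j ≠ i)
ifNe : {n : ℕ} → Fin n → Fin n → ℕ → ℕ
ifNe j i x with j ≟ i
... | yes _ = 0
... | no  _ = x

-- A rooted graph on the vertex set Fin (suc k) (nonempty since it has a root),
-- given by a Boolean adjacency relation and a root.
record RGraph : Set where
  field
    k    : ℕ
    adj  : Fin (suc k) → Fin (suc k) → Bool
    root : Fin (suc k)
open RGraph public

∣_∣ : RGraph → ℕ
∣ G ∣ = suc (k G)

V : RGraph → Set
V G = Fin (suc (k G))

IsSimple : RGraph → Set
IsSimple G = (∀ i j → adj G i j ≡ adj G j i) × (∀ i → adj G i i ≡ false)

walkB : (G : RGraph) → ℕ → V G → V G → Bool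
walkB G zero    i j = does (i ≟ j)
walkB G (suc n) i j = any (λ l → adj G i l ∧ walkB G n l j) (allFin (suc (k G)))

Connected : RGraph → Set
Connected G = ∀ (i j : V G) → ∃[ n ] (walkB G n i j ≡ true)

search : (G : RGraph) → V G → V G → (fuel m : ℕ) → ℕ
search G i j zero       m = m
search G i j (suc fuel) m = if walkB G m i j then m else search G i j fuel (suc m)

-- shortest-path distance: least length of a walk from i to j
-- (a shortest walk is a path, of length < |G|, so searching lengths 0 … |G|-1 suffices)
dist : (G : RGraph) → V G → V G → ℕ
dist G i j = search G i j ∣ G ∣ 0

δ : RGraph → ℕ
δ G = ∑ ∣ G ∣ (λ i → ∑ ∣ G ∣ (λ j → dist G i j))

δ₀ : RGraph → ℕ
δ₀ G = ∑ ∣ G ∣ (λ j → dist G (root G) j)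

adjM : {N : ℕ} → (Fin N → Fin N → Bool) → Maybe (Fin N) → Maybe (Fin N) → Bool
adjM a (just x) (just y) = a x y
adjM a _        _        = false

-- One-point union G ∨ H on vertex set Fin (suc a + b) (|G| = suc a, |H| = suc b):
-- the first suc a vertices are those of G; the remaining b vertices are the
-- non-root vertices of H (enumerated via punchIn (root H)); the root of H is
-- identified with the root of G, which is the root of the union.
module _ (G H : RGraph) where
  private
    a = k G
    b = k H

  gPart : Fin (suc a + b) → Maybe (V G)
  gPart u with splitAt (suc a) u
  ... | inj₁ i = just i
  ... | inj₂ _ = nothing

  hPart : Fin (suc a + b) → Maybe (V H)
  hPart u with splitAt (suc a) u
  ... | inj₁ i with i ≟ root G
  ...   | yes _ = just (root H)
  ...   | no  _ = nothing
  hPart u | inj₂ j = just (punchIn (root H) j)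

  _∨ᵍ_ : RGraph
  _∨ᵍ_ = record
    { k    = a + b
    ; adj  = λ u v → adjM (adj G) (gPart u) (gPart v) ∨ adjM (adj H) (hPart u) (hPart v)
    ; root = root G ↑ˡ b
    }

⋁ : (m : ℕ) → (Fin (suc m) → RGraph) → RGraph
⋁ zero    Gs = Gs zero
⋁ (suc m) Gs = (⋁ m (λ i → Gs (inject₁ i))) ∨ᵍ (Gs (fromℕ (suc m)))

module Submission where

-- In U = G ∨ H every vertex u has a G-coordinate ψG u (itself if u lies
-- in G, the root of G otherwise) and an H-coordinate ψH u.  Every edge of U
-- moves exactly one coordinate along an edge of G or of H, and G, H embed into
-- U, so  d_U(u,v) = d_G(ψG u, ψG v) + d_H(ψH u, ψH v).  Summing along ψG counts
-- every vertex of G once and the root of G a further |H| - 1 times, which gives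
--   δ₀(G ∨ H) = δ₀ G + δ₀ H,
--   δ (G ∨ H) = δ G + δ H + 2 (|H| - 1) δ₀ G + 2 (|G| - 1) δ₀ H.
-- Induction on the number of summands then yields the iterated formulas, the
-- second one first in the subtraction-free form
--   δ(⋁ Gᵢ) + 2 Σ δ₀ Gᵢ kᵢ = Σ δ Gᵢ + 2 (Σ kᵢ)(Σ δ₀ Gᵢ)   (kᵢ = |Gᵢ| - 1),
-- which is finally rewritten over ℤ, using 1 - n + Σ_{j≠i} |Gⱼ| = Σ kⱼ - kᵢ.

open import Defs
open import Data.Nat as ℕ using (ℕ; suc)
open import Data.Fin using (Fin)
open import Data.Product using (_×_; _,_)
open import Relation.Binary.PropositionalEquality using (_≡_)

module FiniteSums where
  open import Data.Nat using (zero; _+_; _*_)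
  open import Data.Nat.Properties using (+-assoc; +-comm; *-identityʳ; *-zeroʳ; *-distribˡ-+)
  open import Data.Nat.Tactic.RingSolver using (solve-∀)
  open import Data.Fin using (zero; suc; punchIn; _↑ˡ_; _↑ʳ_; inject₁; fromℕ; _≟_)
  open import Data.Fin.Properties using (punchInᵢ≢i)
  open import Relation.Nullary using (yes; no; ¬_; contradiction)
  open import Relation.Binary.PropositionalEquality using (refl; sym; trans; cong; cong₂; module ≡-Reasoning)
  open ≡-Reasoning

  ∑-cong : ∀ n {f g : Fin n → ℕ} → (∀ i → f i ≡ g i) → ∑ n f ≡ ∑ n g
  ∑-cong zero    f≗g = refl
  ∑-cong (suc n) f≗g = cong₂ _+_ (f≗g zero) (∑-cong n (λ i → f≗g (suc i)))

  ∑-+ : ∀ n (f g : Fin n → ℕ) → ∑ n (λ i → f i + g i) ≡ ∑ n f + ∑ n g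
  ∑-+ zero    f g = refl
  ∑-+ (suc n) f g rewrite ∑-+ n (λ i → f (suc i)) (λ i → g (suc i)) = interchange (f zero) (g zero) _ _
    where
    interchange : ∀ x y z w → x + y + (z + w) ≡ x + z + (y + w)
    interchange = solve-∀

  ∑-*ˡ : ∀ n c (f : Fin n → ℕ) → ∑ n (λ i → c * f i) ≡ c * ∑ n f
  ∑-*ˡ zero    c f = sym (*-zeroʳ c)
  ∑-*ˡ (suc n) c f rewrite ∑-*ˡ n c (λ i → f (suc i)) = sym (*-distribˡ-+ c (f zero) _)

  ∑-const : ∀ n c → ∑ n (λ _ → c) ≡ n * c
  ∑-const zero    c = refl
  ∑-const (suc n) c = cong (c +_) (∑-const n c)

  ∑-suc : ∀ n (f : Fin n → ℕ) → ∑ n (λ i → suc (f i)) ≡ n + ∑ n f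
  ∑-suc n f = trans (∑-+ n (λ _ → 1) f) (cong (_+ ∑ n f) (trans (∑-const n 1) (*-identityʳ n)))

  ∑-split : ∀ m n (f : Fin (m + n) → ℕ)
    → ∑ (m + n) f ≡ ∑ m (λ i → f (i ↑ˡ n)) + ∑ n (λ j → f (m ↑ʳ j))
  ∑-split zero    n f = refl
  ∑-split (suc m) n f rewrite ∑-split m n (λ i → f (suc i)) = sym (+-assoc (f zero) _ _)

  ∑-punch : ∀ n (p : Fin (suc n)) (f : Fin (suc n) → ℕ) → ∑ (suc n) f ≡ f p + ∑ n (λ j → f (punchIn p j))
  ∑-punch n       zero    f = refl
  ∑-punch (suc n) (suc p) f rewrite ∑-punch n p (λ i → f (suc i)) = swap (f zero) (f (suc p)) _
    where
    swap : ∀ x y z → x + (y + z) ≡ y + (x + z)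
    swap = solve-∀

  ∑-last : ∀ n (f : Fin (suc n) → ℕ) → ∑ (suc n) f ≡ ∑ n (λ i → f (inject₁ i)) + f (fromℕ n)
  ∑-last zero    f = +-comm (f zero) 0
  ∑-last (suc n) f rewrite ∑-last n (λ i → f (suc i)) = sym (+-assoc (f zero) _ _)

  ifNe-self : ∀ {n} (i : Fin n) x → ifNe i i x ≡ 0
  ifNe-self i x with i ≟ i
  ... | yes _  = refl
  ... | no i≢i = contradiction refl i≢i

  ifNe-≢ : ∀ {n} {j i : Fin n} x → ¬ j ≡ i → ifNe j i x ≡ x
  ifNe-≢ {j = j} {i} x j≢i with j ≟ i
  ... | yes j≡i = contradiction j≡i j≢i
  ... | no _    = refl

  ∑-except : ∀ n (i : Fin (suc n)) (f : Fin (suc n) → ℕ)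
    → ∑ (suc n) (λ j → ifNe j i (f j)) + f i ≡ ∑ (suc n) f
  ∑-except n i f = begin
    ∑ (suc n) (λ j → ifNe j i (f j)) + f i
      ≡⟨ cong (_+ f i) (∑-punch n i (λ j → ifNe j i (f j))) ⟩
    ifNe i i (f i) + ∑ n (λ j → ifNe (punchIn i j) i (f (punchIn i j))) + f i
      ≡⟨ cong₂ (λ x y → x + y + f i) (ifNe-self i (f i)) (∑-cong n (λ j → ifNe-≢ _ (punchInᵢ≢i i j))) ⟩
    ∑ n (λ j → f (punchIn i j)) + f i
      ≡⟨ +-comm _ (f i) ⟩
    f i + ∑ n (λ j → f (punchIn i j))
      ≡⟨ sym (∑-punch n i f) ⟩
    ∑ (suc n) f ∎

module Distances where
  open import Data.Nat using (zero; _+_; _≤_; _<_; z≤n; s≤s; s≤s⁻¹; _<?_) renaming (_≟_ to _≟ℕ_)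
  open import Data.Nat.Properties using (≤-refl; ≤-antisym; ≮⇒≥; +-identityʳ; +-suc; +-comm; m≤n⇒m<n∨m≡n; ≤∧≢⇒<)
  open import Data.Bool using (true; false)
  open import Data.Bool.Properties using (T-≡; T-∧)
  open import Data.Fin using (toℕ; _≟_)
  open import Data.Fin.Properties using (toℕ-injective; toℕ<n; injective⇒≤)
  open import Data.List using (allFin)
  open import Data.List.Relation.Unary.Any using (satisfied)
  open import Data.List.Relation.Unary.Any.Properties using (any⁺; any⁻)
  open import Data.List.Membership.Propositional using (lose)
  open import Data.List.Membership.Propositional.Properties using (∈-allFin)
  open import Data.Product using (∃; proj₁; proj₂)
  open import Data.Sum using (_⊎_; inj₁; inj₂)
  open import Function.Bundles using (Equivalence)
  open import Relation.Nullary using (yes; no; ¬_; contradiction)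
  open import Relation.Nullary.Decidable using (dec-true)
  open import Relation.Binary.PropositionalEquality using (refl; sym; trans; subst)
  open Equivalence using (to; from)

  -- The Boolean facts of Defs wrapped in records, so that their indices can
  -- be inferred from them.
  record Edge (G : RGraph) (i j : V G) : Set where
    constructor edge
    field isEdge : adj G i j ≡ true

  record Walk (G : RGraph) (n : ℕ) (i j : V G) : Set where
    constructor walk
    field isWalk : walkB G n i j ≡ true
  open Walk public

  NoWalkBelow : (G : RGraph) → ℕ → V G → V G → Set
  NoWalkBelow G m i j = ∀ n → n < m → ¬ Walk G n i j

  Shortest : (G : RGraph) → ℕ → V G → V G → Set
  Shortest G d i j = Walk G d i j × NoWalkBelow G d i j

  module _ {G : RGraph} where

    walk-nil : ∀ i → Walk G 0 i i
    walk-nil i = walk (dec-true (i ≟ i) refl)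

    walk-nil⁻ : ∀ {i j} → Walk G 0 i j → i ≡ j
    walk-nil⁻ {i} {j} (walk w) with i ≟ j
    ... | yes i≡j = i≡j

    walk-cons : ∀ {n i l j} → Edge G i l → Walk G n l j → Walk G (suc n) i j
    walk-cons {l = l} (edge e) (walk w) =
      walk (to T-≡ (any⁺ _ (lose (∈-allFin l) (from T-∧ (from T-≡ e , from T-≡ w)))))

    walk-uncons : ∀ {n i j} → Walk G (suc n) i j → ∃ λ l → Edge G i l × Walk G n l j
    walk-uncons (walk w) with satisfied (any⁻ _ (allFin _) (from T-≡ w))
    ... | l , t = l , edge (to T-≡ (proj₁ (to T-∧ t))) , walk (to T-≡ (proj₂ (to T-∧ t)))

    walk-++ : ∀ n {m x y z} → Walk G n x y → Walk G m y z → Walk G (n + m) x z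
    walk-++ zero    {m} {z = z} w₁ w₂ = subst (λ v → Walk G m v z) (sym (walk-nil⁻ w₁)) w₂
    walk-++ (suc n) w₁ w₂ with walk-uncons {n} w₁
    ... | l , e , w = walk-cons e (walk-++ n w w₂)

    walk-reverse : (∀ i j → adj G i j ≡ adj G j i) → ∀ n {i j} → Walk G n i j → Walk G n j i
    walk-reverse sym-adj zero    {i} w = subst (λ v → Walk G 0 v i) (walk-nil⁻ w) (walk-nil i)
    walk-reverse sym-adj (suc n) {i} {j} w with walk-uncons {n} w
    ... | l , e , w′ = subst (λ len → Walk G len j i) (+-comm n 1)
          (walk-++ n (walk-reverse sym-adj n w′) (walk-cons (edge (trans (sym-adj _ _) (Edge.isEdge e))) (walk-nil i)))

    shortest-minimal : ∀ {d n i j} → Shortest G d i j → Walk G n i j → d ≤ n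
    shortest-minimal {d} {n} (_ , below) w with n <? d
    ... | yes n<d = contradiction w (below n n<d)
    ... | no  n≮d = ≮⇒≥ n≮d

    shortest-unique : ∀ {d d′ i j} → Shortest G d i j → Shortest G d′ i j → d ≡ d′
    shortest-unique s s′ = ≤-antisym (shortest-minimal s (proj₁ s′)) (shortest-minimal s′ (proj₁ s))

    search-spec : ∀ {i j} fuel m → NoWalkBelow G m i j
      → Shortest G (search G i j fuel m) i j ⊎ NoWalkBelow G (m + fuel) i j
    search-spec {i} {j} zero m below = inj₂ (subst (λ b → NoWalkBelow G b i j) (sym (+-identityʳ m)) below)
    search-spec {i} {j} (suc fuel) m below with walkB G m i j in found
    ... | true  = inj₁ (walk found , below)
    ... | false with search-spec fuel (suc m) below′
      where
      below′ : NoWalkBelow G (suc m) i j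
      below′ n n<1+m with m≤n⇒m<n∨m≡n (s≤s⁻¹ n<1+m)
      ... | inj₁ n<m  = below n n<m
      ... | inj₂ refl = λ w → contradiction (trans (sym found) (isWalk w)) λ ()
    ...   | inj₁ s     = inj₁ s
    ...   | inj₂ below″ = inj₂ (subst (λ b → NoWalkBelow G b i j) (sym (+-suc m fuel)) below″)

    shortest-exists : ∀ {n i j} → Walk G n i j → ∃ λ d → Shortest G d i j
    shortest-exists {n} w with search-spec (suc n) 0 (λ _ ())
    ... | inj₁ s     = _ , s
    ... | inj₂ below = contradiction w (below n ≤-refl)

    shortest-tail : ∀ {d i l j} → Shortest G (suc d) i j → Edge G i l → Walk G d l j → Shortest G d l j
    shortest-tail (_ , below) e w = w , λ n n<d w′ → below (suc n) (s≤s n<d) (walk-cons e w′)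

    shortest-level : ∀ d {i j} → Shortest G d i j → ∀ k → k ≤ d → ∃ λ v → Shortest G k v j
    shortest-level zero    {i} s .zero z≤n = i , s
    shortest-level (suc d) {i} s k k≤1+d with k ≟ℕ suc d | walk-uncons {d} (proj₁ s)
    ... | yes refl | _         = i , s
    ... | no  k≢1+d | l , e , w = shortest-level d (shortest-tail s e w) k (s≤s⁻¹ (≤∧≢⇒< k≤1+d k≢1+d))

    -- Pigeonhole: the d + 1 levels of a shortest walk are distinct vertices,
    -- so a shortest walk is shorter than the number of vertices.
    shortest-bound : ∀ {d i j} → Shortest G d i j → d < ∣ G ∣
    shortest-bound {d} {i} {j} s = injective⇒≤ {f = vertexAt} vertexAt-injective
      where
      level : (x : Fin (suc d)) → ∃ λ v → Shortest G (toℕ x) v j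
      level x = shortest-level d s (toℕ x) (s≤s⁻¹ (toℕ<n x))
      vertexAt : Fin (suc d) → V G
      vertexAt x = proj₁ (level x)
      vertexAt-injective : ∀ {x y} → vertexAt x ≡ vertexAt y → x ≡ y
      vertexAt-injective {x} {y} same = toℕ-injective (shortest-unique (proj₂ (level x))
        (subst (λ v → Shortest G (toℕ y) v j) (sym same) (proj₂ (level y))))

    dist-shortest : ∀ {n i j} → Walk G n i j → Shortest G (dist G i j) i j
    dist-shortest w with shortest-exists w
    ... | d , s with search-spec ∣ G ∣ 0 (λ _ ())
    ...   | inj₁ s′    = s′
    ...   | inj₂ below = contradiction (proj₁ s) (below d (shortest-bound s))

    dist-walk : ∀ {n i j} → Walk G n i j → Walk G (dist G i j) i j
    dist-walk w = proj₁ (dist-shortest w)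

    dist-≤ : ∀ {n i j} → Walk G n i j → dist G i j ≤ n
    dist-≤ w = shortest-minimal (dist-shortest w) w

    dist-unique : ∀ {d i j} → Walk G d i j → (∀ n → Walk G n i j → d ≤ n) → dist G i j ≡ d
    dist-unique w minimal = ≤-antisym (dist-≤ w) (minimal _ (dist-walk w))

    dist-self : ∀ i → dist G i i ≡ 0
    dist-self i = dist-unique (walk-nil i) (λ _ _ → z≤n)

    dist-edge : ∀ {n i l j} → Edge G i l → Walk G n l j → dist G i j ≤ suc (dist G l j)
    dist-edge e w = dist-≤ (walk-cons e (dist-walk w))

    connected-walk : (conn : Connected G) → ∀ i j → Walk G (proj₁ (conn i j)) i j
    connected-walk conn i j = walk (proj₂ (conn i j))

    dist-sym : IsSimple G → Connected G → ∀ i j → dist G i j ≡ dist G j i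
    dist-sym (sym-adj , _) conn i j = ≤-antisym (flip j i) (flip i j)
      where
      flip : ∀ x y → dist G y x ≤ dist G x y
      flip x y = dist-≤ (walk-reverse sym-adj _ (dist-walk (connected-walk conn x y)))

  walk-map : ∀ {G H : RGraph} (φ : V G → V H) → (∀ x y → Edge G x y → Edge H (φ x) (φ y))
    → ∀ n {x y} → Walk G n x y → Walk H n (φ x) (φ y)
  walk-map {H = H} φ hom zero {x} w = subst (λ v → Walk H 0 (φ x) (φ v)) (walk-nil⁻ w) (walk-nil (φ x))
  walk-map φ hom (suc n) w with walk-uncons w
  ... | l , e , w′ = walk-cons (hom _ _ e) (walk-map φ hom n w′)

module Coverings where
  open FiniteSums
  open Distances
  open import Data.Nat using (_+_; _*_)
  open import Data.Nat.Properties using (*-zeroʳ; +-identityʳ)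
  open import Data.Nat.Tactic.RingSolver using (solve-∀)
  open import Relation.Binary.PropositionalEquality using (trans; cong; cong₂; module ≡-Reasoning)
  open ≡-Reasoning

  Covers : (N : ℕ) (G : RGraph) → (Fin N → V G) → ℕ → Set
  Covers N G ψ c = ∀ (f : V G → ℕ) → ∑ N (λ u → f (ψ u)) ≡ ∑ ∣ G ∣ f + c * f (root G)

  module _ {N : ℕ} {G : RGraph} (ψ : Fin N → V G) (c : ℕ) (covers : Covers N G ψ c) where

    -- The extra copies of the root add dist(root, root) = 0.
    covers-δ₀ : ∑ N (λ v → dist G (root G) (ψ v)) ≡ δ₀ G
    covers-δ₀ = begin
      ∑ N (λ v → dist G (root G) (ψ v))  ≡⟨ covers (dist G (root G)) ⟩
      δ₀ G + c * dist G (root G) (root G)  ≡⟨ cong (λ z → δ₀ G + c * z) (dist-self (root G)) ⟩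
      δ₀ G + c * 0                         ≡⟨ cong (δ₀ G +_) (*-zeroʳ c) ⟩
      δ₀ G + 0                             ≡⟨ +-identityʳ (δ₀ G) ⟩
      δ₀ G                                 ∎

    -- Each of the c extra copies of the root contributes its row and its
    -- column, both equal to δ₀ G by symmetry.
    covers-δ : IsSimple G → Connected G
      → ∑ N (λ u → ∑ N (λ v → dist G (ψ u) (ψ v))) ≡ δ G + 2 * (c * δ₀ G)
    covers-δ simple conn = begin
      ∑ N (λ u → ∑ N (λ v → dist G (ψ u) (ψ v)))
        ≡⟨ ∑-cong N (λ u → covers (dist G (ψ u))) ⟩
      ∑ N (λ u → row (ψ u))
        ≡⟨ covers row ⟩
      ∑ n row + c * row r
        ≡⟨ cong₂ (λ x y → x + c * y) (∑-+ n (λ x → ∑ n (dist G x)) (λ x → c * dist G x r))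
                                      (cong (λ z → δ₀ G + c * z) (dist-self r)) ⟩
      δ G + ∑ n (λ x → c * dist G x r) + c * (δ₀ G + c * 0)
        ≡⟨ cong (λ x → δ G + x + c * (δ₀ G + c * 0))
             (trans (∑-*ˡ n c (λ x → dist G x r)) (cong (c *_) column)) ⟩
      δ G + c * δ₀ G + c * (δ₀ G + c * 0)
        ≡⟨ collect (δ G) c (δ₀ G) ⟩
      δ G + 2 * (c * δ₀ G) ∎
      where
      n : ℕ
      n = ∣ G ∣
      r : V G
      r = root G
      row : V G → ℕ
      row x = ∑ n (dist G x) + c * dist G x r
      column : ∑ n (λ x → dist G x r) ≡ δ₀ G
      column = ∑-cong n (λ x → dist-sym simple conn x r)
      collect : ∀ d c z → d + c * z + c * (z + c * 0) ≡ d + 2 * (c * z)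
      collect = solve-∀

module OnePointUnion (G H : RGraph) where
  open FiniteSums
  open Distances
  open Coverings
  open import Data.Nat using (zero; _+_; _*_; _≤_; s≤s)
  open import Data.Nat.Properties using (+-identityʳ; +-comm; +-suc; ≤-trans; ≤-reflexive; +-monoˡ-≤; +-monoʳ-≤)
  open import Data.Nat.Tactic.RingSolver using (solve-∀)
  open import Data.Bool using (Bool; true; false; _∨_)
  open import Data.Bool.Properties using (T-≡; T-∨; ∨-zeroʳ)
  open import Data.Fin using (splitAt; punchIn; punchOut; _↑ˡ_; _↑ʳ_; _≟_)
  open import Data.Fin.Properties using (splitAt-↑ˡ; splitAt-↑ʳ; join-splitAt; punchInᵢ≢i; punchIn-punchOut; punchOut-punchIn; punchOut-cong)
  open import Data.Maybe using (Maybe; just; nothing; fromMaybe)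
  open import Data.Product using (∃)
  open import Data.Sum using (_⊎_; inj₁; inj₂)
  open import Function.Bundles using (Equivalence)
  open import Relation.Nullary using (yes; no; contradiction)
  open import Relation.Binary.PropositionalEquality using (refl; sym; trans; cong; cong₂; subst; subst₂; module ≡-Reasoning)
  open ≡-Reasoning
  open Equivalence using (to; from)

  a b : ℕ
  a = k G
  b = k H

  rG : V G
  rG = root G
  rH : V H
  rH = root H

  U : RGraph
  U = G ∨ᵍ H

  data Block : V U → Set where
    inG : (i : V G) → Block (i ↑ˡ b)
    inH : (j : Fin b) → Block (suc a ↑ʳ j)

  block : ∀ u → Block u
  block u with splitAt (suc a) u | join-splitAt (suc a) b u
  ... | inj₁ i | u≡i = subst Block u≡i (inG i)
  ... | inj₂ j | u≡j = subst Block u≡j (inH j)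

  ψG : V U → V G
  ψG u = fromMaybe rG (gPart G H u)

  ψH : V U → V H
  ψH u = fromMaybe rH (hPart G H u)

  gPart-inG : ∀ i → gPart G H (i ↑ˡ b) ≡ just i
  gPart-inG i rewrite splitAt-↑ˡ (suc a) i b = refl

  gPart-inH : ∀ j → gPart G H (suc a ↑ʳ j) ≡ nothing
  gPart-inH j rewrite splitAt-↑ʳ (suc a) b j = refl

  hPart-inH : ∀ j → hPart G H (suc a ↑ʳ j) ≡ just (punchIn rH j)
  hPart-inH j rewrite splitAt-↑ʳ (suc a) b j = refl

  hPart-root : hPart G H (rG ↑ˡ b) ≡ just rH
  hPart-root rewrite splitAt-↑ˡ (suc a) rG b with rG ≟ rG
  ... | yes _    = refl
  ... | no rG≢rG = contradiction refl rG≢rG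

  hPart-inG : ∀ i {y} → hPart G H (i ↑ˡ b) ≡ just y → i ≡ rG
  hPart-inG i rewrite splitAt-↑ˡ (suc a) i b with i ≟ rG
  ... | yes i≡rG = λ _ → i≡rG
  ... | no  _    = λ ()

  ψG-inG : ∀ i → ψG (i ↑ˡ b) ≡ i
  ψG-inG i = cong (fromMaybe rG) (gPart-inG i)

  ψH-inG : ∀ i → ψH (i ↑ˡ b) ≡ rH
  ψH-inG i rewrite splitAt-↑ˡ (suc a) i b with i ≟ rG
  ... | yes _ = refl
  ... | no  _ = refl

  ψG-inH : ∀ j → ψG (suc a ↑ʳ j) ≡ rG
  ψG-inH j = cong (fromMaybe rG) (gPart-inH j)

  ψH-inH : ∀ j → ψH (suc a ↑ʳ j) ≡ punchIn rH j
  ψH-inH j = cong (fromMaybe rH) (hPart-inH j)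

  -- A vertex with a G-part lies in the G-block, so its H-coordinate is rH.
  gPart⇒ψH-root : ∀ u {x} → gPart G H u ≡ just x → ψH u ≡ rH
  gPart⇒ψH-root u p with block u
  ... | inG i = ψH-inG i
  ... | inH j with () ← trans (sym (gPart-inH j)) p

  -- A vertex with an H-part is the common root or lies in the H-block.
  hPart⇒ψG-root : ∀ u {y} → hPart G H u ≡ just y → ψG u ≡ rG
  hPart⇒ψG-root u p with block u
  ... | inG i = trans (ψG-inG i) (hPart-inG i p)
  ... | inH j = ψG-inH j

  φG : V G → V U
  φG x = x ↑ˡ b

  φH : V H → V U
  φH y with rH ≟ y
  ... | yes _    = rG ↑ˡ b
  ... | no rH≢y = suc a ↑ʳ punchOut rH≢y

  hPart-φH : ∀ y → hPart G H (φH y) ≡ just y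
  hPart-φH y with rH ≟ y
  ... | yes refl = hPart-root
  ... | no rH≢y  = trans (hPart-inH (punchOut rH≢y)) (cong just (punchIn-punchOut rH≢y))

  φH-root : φH rH ≡ φG rG
  φH-root with rH ≟ rH
  ... | yes _    = refl
  ... | no rH≢rH = contradiction refl rH≢rH

  φH-punchIn : ∀ j → φH (punchIn rH j) ≡ suc a ↑ʳ j
  φH-punchIn j with rH ≟ punchIn rH j
  ... | yes rH≡ = contradiction (sym rH≡) (punchInᵢ≢i rH j)
  ... | no rH≢  = cong (suc a ↑ʳ_) (trans (punchOut-cong rH refl) (punchOut-punchIn rH))

  φG-edge : ∀ x y → Edge G x y → Edge U (φG x) (φG y)
  φG-edge x y (edge e) = edge (cong (_∨ adjM (adj H) (hPart G H (φG x)) (hPart G H (φG y)))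
                                    (trans (cong₂ (adjM (adj G)) (gPart-inG x) (gPart-inG y)) e))

  φH-edge : ∀ x y → Edge H x y → Edge U (φH x) (φH y)
  φH-edge x y (edge e) = edge (trans (cong (adjM (adj G) (gPart G H (φH x)) (gPart G H (φH y)) ∨_)
                                      (trans (cong₂ (adjM (adj H)) (hPart-φH x) (hPart-φH y)) e))
                                (∨-zeroʳ _))

  adjM-true : ∀ {N} (r : Fin N → Fin N → Bool) d p q → adjM r p q ≡ true
    → r (fromMaybe d p) (fromMaybe d q) ≡ true × (∃ λ x → p ≡ just x) × (∃ λ y → q ≡ just y)
  adjM-true r d (just x) (just y) e = e , (x , refl) , (y , refl)

  EdgeStep : V U → V U → Set
  EdgeStep u w = (Edge G (ψG u) (ψG w) × ψH u ≡ ψH w) ⊎ (ψG u ≡ ψG w × Edge H (ψH u) (ψH w))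

  edge-step : ∀ {u w} → Edge U u w → EdgeStep u w
  edge-step {u} {w} (edge e) with to T-∨ (from T-≡ e)
  ... | inj₁ inG-edge with adjM-true (adj G) rG _ _ (to T-≡ inG-edge)
  ...   | eG , (_ , pu) , (_ , pw) = inj₁ (edge eG , trans (gPart⇒ψH-root u pu) (sym (gPart⇒ψH-root w pw)))
  edge-step {u} {w} (edge e) | inj₂ inH-edge with adjM-true (adj H) rH _ _ (to T-≡ inH-edge)
  ...   | eH , (_ , pu) , (_ , pw) = inj₂ (trans (hPart⇒ψG-root u pu) (sym (hPart⇒ψG-root w pw)) , edge eH)

  adjM-sym : ∀ {N} (r : Fin N → Fin N → Bool) → (∀ x y → r x y ≡ r y x) → ∀ p q → adjM r p q ≡ adjM r q p
  adjM-sym r sym-r (just x) (just y) = sym-r x y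
  adjM-sym r sym-r (just x) nothing  = refl
  adjM-sym r sym-r nothing  (just y) = refl
  adjM-sym r sym-r nothing  nothing  = refl

  adjM-irrefl : ∀ {N} (r : Fin N → Fin N → Bool) → (∀ x → r x x ≡ false) → ∀ p → adjM r p p ≡ false
  adjM-irrefl r irr (just x) = irr x
  adjM-irrefl r irr nothing  = refl

  simple-∨ : IsSimple G → IsSimple H → IsSimple U
  simple-∨ (symG , irrG) (symH , irrH) =
    (λ u v → cong₂ _∨_ (adjM-sym (adj G) symG (gPart G H u) (gPart G H v))
                       (adjM-sym (adj H) symH (hPart G H u) (hPart G H v))) ,
    (λ u → cong₂ _∨_ (adjM-irrefl (adj G) irrG (gPart G H u)) (adjM-irrefl (adj H) irrH (hPart G H u)))

  N : ℕ
  N = ∣ U ∣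

  covers-ψG : Covers N G ψG b
  covers-ψG f = begin
    ∑ (suc a + b) (λ u → f (ψG u))
      ≡⟨ ∑-split (suc a) b (λ u → f (ψG u)) ⟩
    ∑ (suc a) (λ i → f (ψG (i ↑ˡ b))) + ∑ b (λ j → f (ψG (suc a ↑ʳ j)))
      ≡⟨ cong₂ _+_ (∑-cong (suc a) (λ i → cong f (ψG-inG i))) (∑-cong b (λ j → cong f (ψG-inH j))) ⟩
    ∑ (suc a) f + ∑ b (λ _ → f rG)
      ≡⟨ cong (∑ (suc a) f +_) (∑-const b (f rG)) ⟩
    ∑ (suc a) f + b * f rG ∎

  covers-ψH : Covers N H ψH a
  covers-ψH f = begin
    ∑ (suc a + b) (λ u → f (ψH u))
      ≡⟨ ∑-split (suc a) b (λ u → f (ψH u)) ⟩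
    ∑ (suc a) (λ i → f (ψH (i ↑ˡ b))) + ∑ b (λ j → f (ψH (suc a ↑ʳ j)))
      ≡⟨ cong₂ _+_ (∑-cong (suc a) (λ i → cong f (ψH-inG i))) (∑-cong b (λ j → cong f (ψH-inH j))) ⟩
    ∑ (suc a) (λ _ → f rH) + ∑ b (λ j → f (punchIn rH j))
      ≡⟨ cong (_+ ∑ b (λ j → f (punchIn rH j))) (∑-const (suc a) (f rH)) ⟩
    suc a * f rH + ∑ b (λ j → f (punchIn rH j))
      ≡⟨ reorder (f rH) a _ ⟩
    (f rH + ∑ b (λ j → f (punchIn rH j))) + a * f rH
      ≡⟨ cong (_+ a * f rH) (sym (∑-punch b rH f)) ⟩
    ∑ (suc b) f + a * f rH ∎
    where
    reorder : ∀ x a s → suc a * x + s ≡ (x + s) + a * x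
    reorder = solve-∀

  module _ (connG : Connected G) (connH : Connected H) where

    E : V U → V U → ℕ
    E u v = dist G (ψG u) (ψG v) + dist H (ψH u) (ψH v)

    E-edge : ∀ {u w} v → Edge U u w → E u v ≤ suc (E w v)
    E-edge {u} {w} v e with edge-step e
    ... | inj₁ (eG , ψH≡) rewrite ψH≡ =
      +-monoˡ-≤ (dist H (ψH w) (ψH v)) (dist-edge eG (connected-walk connG (ψG w) (ψG v)))
    ... | inj₂ (ψG≡ , eH) rewrite ψG≡ = ≤-trans
      (+-monoʳ-≤ (dist G (ψG w) (ψG v)) (dist-edge eH (connected-walk connH (ψH w) (ψH v))))
      (≤-reflexive (+-suc (dist G (ψG w) (ψG v)) (dist H (ψH w) (ψH v))))

    E-self : ∀ v → E v v ≡ 0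
    E-self v = cong₂ _+_ (dist-self (ψG v)) (dist-self (ψH v))

    E-lower : ∀ n {u v} → Walk U n u v → E u v ≤ n
    E-lower zero    {u} {v} w = subst (λ x → E x v ≤ 0) (sym (walk-nil⁻ w)) (≤-reflexive (E-self v))
    E-lower (suc n) {u} {v} w with walk-uncons w
    ... | x , e , w′ = ≤-trans (E-edge v e) (s≤s (E-lower n w′))

    walk-inG : ∀ x y → Walk U (dist G x y) (φG x) (φG y)
    walk-inG x y = walk-map φG φG-edge (dist G x y) (dist-walk (connected-walk connG x y))

    walk-inH : ∀ x y → Walk U (dist H x y) (φH x) (φH y)
    walk-inH x y = walk-map φH φH-edge (dist H x y) (dist-walk (connected-walk connH x y))

    E-at : ∀ u v {x x′ y y′} → ψG u ≡ x → ψG v ≡ x′ → ψH u ≡ y → ψH v ≡ y′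
      → E u v ≡ dist G x x′ + dist H y y′
    E-at u v refl refl refl refl = refl

    resize : ∀ {m n u v} → m ≡ n → Walk U m u v → Walk U n u v
    resize {u = u} {v} m≡n = subst (λ len → Walk U len u v) m≡n

    -- E is realised by a walk: within one block stay in that component,
    -- between the blocks pass through the common root.
    E-upper : ∀ u v → Walk U (E u v) u v
    E-upper u v with block u | block v
    ... | inG i | inG i′ = resize (sym E≡) (walk-inG i i′)
      where
      E≡ : E (i ↑ˡ b) (i′ ↑ˡ b) ≡ dist G i i′
      E≡ = trans (E-at (i ↑ˡ b) (i′ ↑ˡ b) (ψG-inG i) (ψG-inG i′) (ψH-inG i) (ψH-inG i′))
                 (trans (cong (dist G i i′ +_) (dist-self rH)) (+-identityʳ _))
    ... | inG i | inH j′ = resize (sym E≡)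
      (walk-++ (dist G i rG) (walk-inG i rG)
        (subst₂ (Walk U _) φH-root (φH-punchIn j′) (walk-inH rH (punchIn rH j′))))
      where
      E≡ : E (i ↑ˡ b) (suc a ↑ʳ j′) ≡ dist G i rG + dist H rH (punchIn rH j′)
      E≡ = E-at (i ↑ˡ b) (suc a ↑ʳ j′) (ψG-inG i) (ψG-inH j′) (ψH-inG i) (ψH-inH j′)
    ... | inH j | inG i′ = resize (sym E≡)
      (walk-++ (dist H (punchIn rH j) rH)
        (subst₂ (Walk U _) (φH-punchIn j) φH-root (walk-inH (punchIn rH j) rH)) (walk-inG rG i′))
      where
      E≡ : E (suc a ↑ʳ j) (i′ ↑ˡ b) ≡ dist H (punchIn rH j) rH + dist G rG i′
      E≡ = trans (E-at (suc a ↑ʳ j) (i′ ↑ˡ b) (ψG-inH j) (ψG-inG i′) (ψH-inH j) (ψH-inG i′))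
                 (+-comm (dist G rG i′) (dist H (punchIn rH j) rH))
    ... | inH j | inH j′ = resize (sym E≡)
      (subst₂ (Walk U _) (φH-punchIn j) (φH-punchIn j′) (walk-inH (punchIn rH j) (punchIn rH j′)))
      where
      E≡ : E (suc a ↑ʳ j) (suc a ↑ʳ j′) ≡ dist H (punchIn rH j) (punchIn rH j′)
      E≡ = trans (E-at (suc a ↑ʳ j) (suc a ↑ʳ j′) (ψG-inH j) (ψG-inH j′) (ψH-inH j) (ψH-inH j′))
                 (cong (_+ dist H (punchIn rH j) (punchIn rH j′)) (dist-self rG))

    connected-∨ : Connected U
    connected-∨ u v = E u v , isWalk (E-upper u v)

    dist-∨ : ∀ u v → dist U u v ≡ E u v
    dist-∨ u v = dist-unique (E-upper u v) (λ n → E-lower n)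

    δ₀-∨ : δ₀ U ≡ δ₀ G + δ₀ H
    δ₀-∨ = begin
      ∑ N (λ v → dist U (root U) v)
        ≡⟨ ∑-cong N (λ v → trans (dist-∨ (root U) v)
             (cong₂ (λ x y → dist G x (ψG v) + dist H y (ψH v)) (ψG-inG rG) (ψH-inG rG))) ⟩
      ∑ N (λ v → dist G rG (ψG v) + dist H rH (ψH v))
        ≡⟨ ∑-+ N (λ v → dist G rG (ψG v)) (λ v → dist H rH (ψH v)) ⟩
      ∑ N (λ v → dist G rG (ψG v)) + ∑ N (λ v → dist H rH (ψH v))
        ≡⟨ cong₂ _+_ (covers-δ₀ ψG b covers-ψG) (covers-δ₀ ψH a covers-ψH) ⟩
      δ₀ G + δ₀ H ∎

    δ-∨ : IsSimple G → IsSimple H → δ U ≡ (δ G + 2 * (b * δ₀ G)) + (δ H + 2 * (a * δ₀ H))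
    δ-∨ simpleG simpleH = begin
      ∑ N (λ u → ∑ N (λ v → dist U u v))
        ≡⟨ ∑-cong N (λ u → trans (∑-cong N (dist-∨ u))
                                  (∑-+ N (λ v → dist G (ψG u) (ψG v)) (λ v → dist H (ψH u) (ψH v)))) ⟩
      ∑ N (λ u → ∑ N (λ v → dist G (ψG u) (ψG v)) + ∑ N (λ v → dist H (ψH u) (ψH v)))
        ≡⟨ ∑-+ N (λ u → ∑ N (λ v → dist G (ψG u) (ψG v))) (λ u → ∑ N (λ v → dist H (ψH u) (ψH v))) ⟩
      ∑ N (λ u → ∑ N (λ v → dist G (ψG u) (ψG v))) + ∑ N (λ u → ∑ N (λ v → dist H (ψH u) (ψH v)))
        ≡⟨ cong₂ _+_ (covers-δ ψG b covers-ψG simpleG connG) (covers-δ ψH a covers-ψH simpleH connH) ⟩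
      (δ G + 2 * (b * δ₀ G)) + (δ H + 2 * (a * δ₀ H)) ∎

module IteratedUnion where
  open FiniteSums
  open import Data.Nat using (zero; _+_; _*_)
  open import Data.Nat.Properties using (+-identityʳ)
  open import Data.Nat.Tactic.RingSolver using (solve-∀)
  open import Data.Fin using (inject₁; fromℕ) renaming (zero to fzero)
  open import Relation.Binary.PropositionalEquality using (sym; trans; cong; cong₂; module ≡-Reasoning)
  open ≡-Reasoning

  init : ∀ {m} → (Fin (suc (suc m)) → RGraph) → Fin (suc m) → RGraph
  init Gs i = Gs (inject₁ i)

  last : ∀ {m} → (Fin (suc (suc m)) → RGraph) → RGraph
  last {m} Gs = Gs (fromℕ (suc m))

  ⋁-simple : ∀ m (Gs : Fin (suc m) → RGraph) → (∀ i → IsSimple (Gs i)) → IsSimple (⋁ m Gs)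
  ⋁-simple zero    Gs simple = simple fzero
  ⋁-simple (suc m) Gs simple =
    OnePointUnion.simple-∨ (⋁ m (init Gs)) (last Gs) (⋁-simple m (init Gs) (λ i → simple (inject₁ i))) (simple _)

  ⋁-connected : ∀ m (Gs : Fin (suc m) → RGraph) → (∀ i → Connected (Gs i)) → Connected (⋁ m Gs)
  ⋁-connected zero    Gs conn = conn fzero
  ⋁-connected (suc m) Gs conn =
    OnePointUnion.connected-∨ (⋁ m (init Gs)) (last Gs) (⋁-connected m (init Gs) (λ i → conn (inject₁ i))) (conn _)

  -- |⋁ Gs| - 1 = Σ (|Gᵢ| - 1): only the roots are identified.
  ⋁-size : ∀ m (Gs : Fin (suc m) → RGraph) → k (⋁ m Gs) ≡ ∑ (suc m) (λ i → k (Gs i))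
  ⋁-size zero    Gs = sym (+-identityʳ (k (Gs fzero)))
  ⋁-size (suc m) Gs = trans (cong (_+ k (last Gs)) (⋁-size m (init Gs))) (sym (∑-last (suc m) (λ i → k (Gs i))))

  δ₀-⋁ : ∀ m (Gs : Fin (suc m) → RGraph) → (∀ i → Connected (Gs i))
    → δ₀ (⋁ m Gs) ≡ ∑ (suc m) (λ i → δ₀ (Gs i))
  δ₀-⋁ zero    Gs conn = sym (+-identityʳ (δ₀ (Gs fzero)))
  δ₀-⋁ (suc m) Gs conn = begin
    δ₀ (⋁ m (init Gs) ∨ᵍ last Gs)
      ≡⟨ OnePointUnion.δ₀-∨ (⋁ m (init Gs)) (last Gs) (⋁-connected m (init Gs) conn′) (conn _) ⟩
    δ₀ (⋁ m (init Gs)) + δ₀ (last Gs)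
      ≡⟨ cong (_+ δ₀ (last Gs)) (δ₀-⋁ m (init Gs) conn′) ⟩
    ∑ (suc m) (λ i → δ₀ (init Gs i)) + δ₀ (last Gs)
      ≡⟨ sym (∑-last (suc m) (λ i → δ₀ (Gs i))) ⟩
    ∑ (suc (suc m)) (λ i → δ₀ (Gs i)) ∎
    where
    conn′ : ∀ i → Connected (init Gs i)
    conn′ i = conn (inject₁ i)

  δ-⋁ : ∀ m (Gs : Fin (suc m) → RGraph) → (∀ i → IsSimple (Gs i)) → (∀ i → Connected (Gs i))
    → δ (⋁ m Gs) + 2 * ∑ (suc m) (λ i → δ₀ (Gs i) * k (Gs i))
      ≡ ∑ (suc m) (λ i → δ (Gs i)) + 2 * (∑ (suc m) (λ i → k (Gs i)) * ∑ (suc m) (λ i → δ₀ (Gs i)))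
  δ-⋁ zero    Gs simple conn = base (δ (Gs fzero)) (δ₀ (Gs fzero)) (k (Gs fzero))
    where
    base : ∀ d d₀ k → d + 2 * (d₀ * k + 0) ≡ (d + 0) + 2 * ((k + 0) * (d₀ + 0))
    base = solve-∀
  δ-⋁ (suc m) Gs simple conn = begin
    δ (P ∨ᵍ Gₙ) + 2 * ∑ (suc (suc m)) (λ i → δ₀ (Gs i) * k (Gs i))
      ≡⟨ cong₂ (λ x y → x + 2 * y)
           (OnePointUnion.δ-∨ P Gₙ (⋁-connected m (init Gs) conn′) (conn _)
                                   (⋁-simple m (init Gs) simple′) (simple _))
           (∑-last (suc m) (λ i → δ₀ (Gs i) * k (Gs i))) ⟩
    (δ P + 2 * (k Gₙ * δ₀ P)) + (δ Gₙ + 2 * (k P * δ₀ Gₙ)) + 2 * (DK + δ₀ Gₙ * k Gₙ)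
      ≡⟨ cong₂ (λ t s → (δ P + 2 * (k Gₙ * t)) + (δ Gₙ + 2 * (s * δ₀ Gₙ)) + 2 * (DK + δ₀ Gₙ * k Gₙ))
           (δ₀-⋁ m (init Gs) conn′) (⋁-size m (init Gs)) ⟩
    (δ P + 2 * (k Gₙ * T₀)) + (δ Gₙ + 2 * (K * δ₀ Gₙ)) + 2 * (DK + δ₀ Gₙ * k Gₙ)
      ≡⟨ split (δ P) (δ Gₙ) DK K T₀ (k Gₙ) (δ₀ Gₙ) ⟩
    (δ P + 2 * DK) + rest
      ≡⟨ cong (_+ rest) (δ-⋁ m (init Gs) simple′ conn′) ⟩
    (SD + 2 * (K * T₀)) + rest
      ≡⟨ merge SD (δ Gₙ) K T₀ (k Gₙ) (δ₀ Gₙ) ⟩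
    (SD + δ Gₙ) + 2 * ((K + k Gₙ) * (T₀ + δ₀ Gₙ))
      ≡⟨ sym (cong₂ (λ x y → x + 2 * y) (∑-last (suc m) (λ i → δ (Gs i)))
           (cong₂ _*_ (∑-last (suc m) (λ i → k (Gs i))) (∑-last (suc m) (λ i → δ₀ (Gs i))))) ⟩
    ∑ (suc (suc m)) (λ i → δ (Gs i))
      + 2 * (∑ (suc (suc m)) (λ i → k (Gs i)) * ∑ (suc (suc m)) (λ i → δ₀ (Gs i))) ∎
    where
    P Gₙ : RGraph
    P  = ⋁ m (init Gs)
    Gₙ = last Gs
    simple′ : ∀ i → IsSimple (init Gs i)
    simple′ i = simple (inject₁ i)
    conn′ : ∀ i → Connected (init Gs i)
    conn′ i = conn (inject₁ i)
    K T₀ SD DK rest : ℕ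
    K    = ∑ (suc m) (λ i → k (init Gs i))
    T₀   = ∑ (suc m) (λ i → δ₀ (init Gs i))
    SD   = ∑ (suc m) (λ i → δ (init Gs i))
    DK   = ∑ (suc m) (λ i → δ₀ (init Gs i) * k (init Gs i))
    rest = δ Gₙ + 2 * (k Gₙ * T₀) + 2 * (K * δ₀ Gₙ) + 2 * (δ₀ Gₙ * k Gₙ)
    split : ∀ d dₙ dk K t kₙ tₙ → (d + 2 * (kₙ * t)) + (dₙ + 2 * (K * tₙ)) + 2 * (dk + tₙ * kₙ)
                                  ≡ (d + 2 * dk) + (dₙ + 2 * (kₙ * t) + 2 * (K * tₙ) + 2 * (tₙ * kₙ))
    split = solve-∀
    merge : ∀ s dₙ K t kₙ tₙ → (s + 2 * (K * t)) + (dₙ + 2 * (kₙ * t) + 2 * (K * tₙ) + 2 * (tₙ * kₙ))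
                               ≡ (s + dₙ) + 2 * ((K + kₙ) * (t + tₙ))
    merge = solve-∀

open import Data.Integer using (ℤ; +_; _+_; _-_; _*_)

module IntegerForm where
  open FiniteSums
  open import Data.Integer.Properties using (pos-+; pos-*)
  open import Data.Integer.Tactic.RingSolver using (solve-∀)
  open import Data.Fin using () renaming (zero to fzero; suc to fsuc)
  open import Relation.Binary.PropositionalEquality using (refl; sym; trans; cong; cong₂; module ≡-Reasoning)
  open ≡-Reasoning

  ∑ℤ-cong : ∀ n {f g : Fin n → ℤ} → (∀ i → f i ≡ g i) → ∑ℤ n f ≡ ∑ℤ n g
  ∑ℤ-cong ℕ.zero    f≗g = refl
  ∑ℤ-cong (suc n) f≗g = cong₂ _+_ (f≗g fzero) (∑ℤ-cong n (λ i → f≗g (fsuc i)))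

  ∑ℤ-pos : ∀ n (f : Fin n → ℕ) → ∑ℤ n (λ i → + f i) ≡ + ∑ n f
  ∑ℤ-pos ℕ.zero    f = refl
  ∑ℤ-pos (suc n) f = trans (cong (_+_ (+ f fzero)) (∑ℤ-pos n (λ i → f (fsuc i)))) (sym (pos-+ (f fzero) _))

  ∑ℤ-weighted-deficit : ∀ n (d e : Fin n → ℤ) K
    → ∑ℤ n (λ i → d i * (K - e i)) ≡ K * ∑ℤ n d - ∑ℤ n (λ i → d i * e i)
  ∑ℤ-weighted-deficit ℕ.zero    d e K = solve-zero K
    where
    solve-zero : ∀ K → + 0 ≡ K * + 0 - + 0
    solve-zero = solve-∀
  ∑ℤ-weighted-deficit (suc n) d e K =
    trans (cong (_+_ (d fzero * (K - e fzero))) (∑ℤ-weighted-deficit n (λ i → d (fsuc i)) (λ i → e (fsuc i)) K))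
          (distribute (d fzero) (e fzero) K _ _)
    where
    distribute : ∀ d₀ e₀ K S T → d₀ * (K - e₀) + (K * S - T) ≡ K * (d₀ + S) - (d₀ * e₀ + T)
    distribute = solve-∀

  ∑ℤ-weighted-deficitℕ : ∀ n (d e : Fin n → ℕ) K
    → ∑ℤ n (λ i → + d i * (+ K - + e i)) ≡ + (K ℕ.* ∑ n d) - + ∑ n (λ i → d i ℕ.* e i)
  ∑ℤ-weighted-deficitℕ n d e K = begin
    ∑ℤ n (λ i → + d i * (+ K - + e i))
      ≡⟨ ∑ℤ-weighted-deficit n (λ i → + d i) (λ i → + e i) (+ K) ⟩
    + K * ∑ℤ n (λ i → + d i) - ∑ℤ n (λ i → + d i * + e i)
      ≡⟨ cong₂ (λ x y → + K * x - y) (∑ℤ-pos n d)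
           (trans (∑ℤ-cong n (λ i → sym (pos-* (d i) (e i)))) (∑ℤ-pos n (λ i → d i ℕ.* e i))) ⟩
    + K * + ∑ n d - + ∑ n (λ i → d i ℕ.* e i)
      ≡⟨ cong (_- + ∑ n (λ i → d i ℕ.* e i)) (sym (pos-* K (∑ n d))) ⟩
    + (K ℕ.* ∑ n d) - + ∑ n (λ i → d i ℕ.* e i) ∎

  deficit : ∀ m (kk : Fin (suc m) → ℕ) i
    → + 1 - + suc m + + ∑ (suc m) (λ j → ifNe j i (suc (kk j))) ≡ + ∑ (suc m) kk - + kk i
  deficit m kk i = begin
    + 1 - n + X                      ≡⟨ rearrange n X (+ kk i) ⟩
    X + (+ 1 + + kk i) - n - + kk i    ≡⟨ cong (λ z → z - n - + kk i) counted ⟩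
    n + + ∑ (suc m) kk - n - + kk i    ≡⟨ cancel n (+ ∑ (suc m) kk) (+ kk i) ⟩
    + ∑ (suc m) kk - + kk i            ∎
    where
    n X : ℤ
    n = + suc m
    X = + ∑ (suc m) (λ j → ifNe j i (suc (kk j)))
    counted : X + (+ 1 + + kk i) ≡ n + + ∑ (suc m) kk
    counted = begin
      X + + suc (kk i)  ≡⟨ sym (pos-+ _ (suc (kk i))) ⟩
      + (∑ (suc m) (λ j → ifNe j i (suc (kk j))) ℕ.+ suc (kk i))
        ≡⟨ cong +_ (trans (∑-except m i (λ j → suc (kk j))) (∑-suc (suc m) kk)) ⟩
      + (suc m ℕ.+ ∑ (suc m) kk) ≡⟨ pos-+ (suc m) _ ⟩
      n + + ∑ (suc m) kk ∎
    rearrange : ∀ n X k → + 1 - n + X ≡ X + (+ 1 + k) - n - k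
    rearrange = solve-∀
    cancel : ∀ n K k → n + K - n - k ≡ K - k
    cancel = solve-∀

  solve-for : ∀ x y z w → x ℕ.+ 2 ℕ.* y ≡ z ℕ.+ 2 ℕ.* w → + x ≡ + z + + 2 * (+ w - + y)
  solve-for x y z w eq = begin
    + x                            ≡⟨ add-sub (+ x) (+ y) ⟩
    + x + + 2 * + y - + 2 * + y    ≡⟨ cong (_- + 2 * + y) cast ⟩
    + z + + 2 * + w - + 2 * + y    ≡⟨ factor (+ z) (+ w) (+ y) ⟩
    + z + + 2 * (+ w - + y)        ∎
    where
    cast : + x + + 2 * + y ≡ + z + + 2 * + w
    cast = begin
      + x + + 2 * + y       ≡⟨ cong (_+_ (+ x)) (sym (pos-* 2 y)) ⟩
      + x + + (2 ℕ.* y)     ≡⟨ sym (pos-+ x (2 ℕ.* y)) ⟩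
      + (x ℕ.+ 2 ℕ.* y)     ≡⟨ cong +_ eq ⟩
      + (z ℕ.+ 2 ℕ.* w)     ≡⟨ pos-+ z (2 ℕ.* w) ⟩
      + z + + (2 ℕ.* w)     ≡⟨ cong (_+_ (+ z)) (pos-* 2 w) ⟩
      + z + + 2 * + w       ∎
    add-sub : ∀ x y → x ≡ x + + 2 * y - + 2 * y
    add-sub = solve-∀
    factor : ∀ z w y → z + + 2 * w - + 2 * y ≡ z + + 2 * (w - y)
    factor = solve-∀

open IteratedUnion using (δ₀-⋁; δ-⋁)
open IntegerForm using (∑ℤ-cong; ∑ℤ-weighted-deficitℕ; deficit; solve-for)
open import Relation.Binary.PropositionalEquality using (sym; cong; module ≡-Reasoning)

mainTheorem4 : (m : ℕ) (Gs : Fin (suc m) → RGraph)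
    → (∀ i → IsSimple (Gs i)) → (∀ i → Connected (Gs i))
    → (δ₀ (⋁ m Gs) ≡ ∑ (suc m) (λ i → δ₀ (Gs i)))
      × (+ δ (⋁ m Gs) ≡ + ∑ (suc m) (λ i → δ (Gs i))
          + + 2 * ∑ℤ (suc m) (λ i → + δ₀ (Gs i)
              * (+ 1 - + suc m + + ∑ (suc m) (λ j → ifNe j i ∣ Gs j ∣))))
mainTheorem4 m Gs simple conn = δ₀-⋁ m Gs conn , (begin
  + δ (⋁ m Gs)
    ≡⟨ solve-for (δ (⋁ m Gs)) DK SD (K ℕ.* T₀) (δ-⋁ m Gs simple conn) ⟩
  + SD + + 2 * (+ (K ℕ.* T₀) - + DK)
    ≡⟨ cong (λ z → + SD + + 2 * z)
         (sym (∑ℤ-weighted-deficitℕ (suc m) (λ i → δ₀ (Gs i)) (λ i → k (Gs i)) K)) ⟩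
  + SD + + 2 * ∑ℤ (suc m) (λ i → + δ₀ (Gs i) * (+ K - + k (Gs i)))
    ≡⟨ cong (λ z → + SD + + 2 * z)
         (∑ℤ-cong (suc m) (λ i → cong (_*_ (+ δ₀ (Gs i))) (sym (deficit m (λ j → k (Gs j)) i)))) ⟩
  + SD + + 2 * ∑ℤ (suc m) (λ i → + δ₀ (Gs i) * (+ 1 - + suc m + + ∑ (suc m) (λ j → ifNe j i ∣ Gs j ∣))) ∎)
  where
  open ≡-Reasoning
  K T₀ SD DK : ℕ
  K  = ∑ (suc m) (λ i → k (Gs i))
  T₀ = ∑ (suc m) (λ i → δ₀ (Gs i))
  SD = ∑ (suc m) (λ i → δ (Gs i))
  DK = ∑ (suc m) (λ i → δ₀ (Gs i) ℕ.* k (Gs i))
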